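{- Let $G$ be a graph with vertex set $\mathbb{N}$ and finite chromatic number $\chi(G)$. Then for every positive integer $n$, $T_G(n)\le \chi(G)^n$.
   Context: Here $\mathbb{N}=\{1,2,3,\dots\}$ and $[n]=\{1,\dots,n\}$. For a graph $G$ on vertex set $\mathbb{N}$, two permutations $\pi,\sigma$ of $[n]$ are $G$-different if there is $i\in[n]$ such that $\{\pi(i),\sigma(i)\}$ is an edge of $G$. $T_G(n)$ is the maximum cardinality of a set of permutations of $[n]$ any two distinct members of which are $G$-different. -}

module Defs where

open import Level using (Level; suc; _⊔_)
open import Data.Nat using (ℕ; _≤_)
open import Data.Fin using (Fin; toℕ)
open import Data.Fin.Permutation using (Permutation′; _⟨$⟩ʳ_)
open import Data.Product using (Σ; ∃; ∃-syntax; _×_)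
open import Relation.Binary.PropositionalEquality using (_≡_; _≢_)
open import Relation.Nullary using (¬_)

-- Agda vertex m represents the paper's vertex m+1, so Agda's ℕ = {0,1,...}
-- is in bijection with the paper's ℕ = {1,2,...}, and [n] = {1..n}
-- corresponds to Fin n via toℕ.
record Graph : Set₁ where
  field
    Edge    : ℕ → ℕ → Set
    symm    : ∀ {x y} → Edge x y → Edge y x
    irrefl  : ∀ {x} → ¬ Edge x x

open Graph public

Colorable : Graph → ℕ → Set
Colorable G k = Σ (ℕ → Fin k) λ c → ∀ x y → Edge G x y → c x ≢ c y

IsChromaticNumber : Graph → ℕ → Set
IsChromaticNumber G k = Colorable G k × (∀ j → Colorable G j → k ≤ j)

GDifferent : Graph → {n : ℕ} → Permutation′ n → Permutation′ n → Set
GDifferent G π σ = ∃[ i ] Edge G (toℕ (π ⟨$⟩ʳ i)) (toℕ (σ ⟨$⟩ʳ i))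

-- A family of m permutations of [n], any two distinct members G-different.
-- (G-different implies distinct since G is loopless, so the family has m
-- distinct members.)
GDifferentFamily : Graph → (n m : ℕ) → Set
GDifferentFamily G n m =
  Σ (Fin m → Permutation′ n) λ f → ∀ a b → a ≢ b → GDifferent G (f a) (f b)

IsT : Graph → ℕ → ℕ → Set
IsT G n T = GDifferentFamily G n T × (∀ m → GDifferentFamily G n m → m ≤ T)

module Submission where

-- Fix a proper colouring c : ℕ → Fin χ of G.  Colouring the
-- values of a permutation π of [n] position by position gives its colour
-- pattern, a word Fin n → Fin χ.  If π and σ are G-different then at some
-- position i the vertices π(i), σ(i) are adjacent, so they receive different
-- colours and the patterns differ.  Hence the members of a G-different
-- family have pairwise distinct patterns; there are only χ ^ n words of
-- length n over χ colours, so the family has at most χ ^ n members.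
--
-- The bound holds for every proper colouring and
-- every G-different family.

open import Defs
open import Data.Nat using (ℕ; _≤_; _^_)
open import Data.Fin using (Fin; toℕ; funToFin; finToFun; _≟_)
open import Data.Fin.Properties using (injective⇒≤; finToFun-funToFin)
open import Data.Fin.Permutation using (Permutation′; _⟨$⟩ʳ_)
open import Data.Product using (_,_)
open import Data.Empty using (⊥-elim)
open import Relation.Nullary using (¬_; yes; no)
open import Relation.Binary.PropositionalEquality
  using (_≡_; _≢_; _≗_; cong; module ≡-Reasoning)

funToFin-pointwise : ∀ {n k} (u v : Fin n → Fin k) →
  funToFin u ≡ funToFin v → u ≗ v
funToFin-pointwise u v codes-equal i = begin
  u i                        ≡⟨ finToFun-funToFin u i ⟨
  finToFun (funToFin u) i    ≡⟨ cong (λ code → finToFun code i) codes-equal ⟩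
  finToFun (funToFin v) i    ≡⟨ finToFun-funToFin v i ⟩
  v i                        ∎
  where open ≡-Reasoning

separated-words-≤ : ∀ {m n k} (w : Fin m → Fin n → Fin k) →
  (∀ a b → a ≢ b → ¬ (w a ≗ w b)) → m ≤ k ^ n
separated-words-≤ {m} {n} {k} w separated = injective⇒≤ {f = code} code-injective
  where
  code : Fin m → Fin (k ^ n)
  code a = funToFin (w a)

  code-injective : ∀ {a b} → code a ≡ code b → a ≡ b
  code-injective {a} {b} codes-equal with a ≟ b
  ... | yes a≡b = a≡b
  ... | no  a≢b = ⊥-elim (separated a b a≢b
                            (funToFin-pointwise (w a) (w b) codes-equal))

colourPattern : ∀ {n k} → (ℕ → Fin k) → Permutation′ n → Fin n → Fin k
colourPattern c π i = c (toℕ (π ⟨$⟩ʳ i))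

GDifferent⇒patterns-differ : ∀ (G : Graph) {n k} (c : ℕ → Fin k) →
  (∀ x y → Edge G x y → c x ≢ c y) →
  (π σ : Permutation′ n) → GDifferent G π σ →
  ¬ (colourPattern c π ≗ colourPattern c σ)
GDifferent⇒patterns-differ G c proper π σ (i , edge) same-pattern =
  proper _ _ edge (same-pattern i)

proposition4 : (G : Graph) (χ : ℕ) → IsChromaticNumber G χ →
    (n : ℕ) → 1 ≤ n → (T : ℕ) → IsT G n T → T ≤ χ ^ n
proposition4 G χ ((c , proper) , _) n _ T ((family , different) , _) =
  separated-words-≤ (λ a → colourPattern c (family a)) λ a b a≢b →
    GDifferent⇒patterns-differ G c proper (family a) (family b)
      (different a b a≢b)
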